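{- For every $m \in \mathbb{N}$ and every $x \in \mathbb{N}$, the list $\mathrm{lgen}_m(x)$ is sorted in non-increasing order and all its elements are $\le m$.
   Context: Lists of natural numbers: $[\,]$ is the empty list, $h :: t$ the list with head $h$ and tail $t$. For $m \in \mathbb{N}$, $\mathrm{next}_m$ is defined recursively by: $\mathrm{next}_m([\,]) = [0]$; $\mathrm{next}_m(h :: t) = (h+1) :: t$ if $h < m$; and if $h \ge m$: $\mathrm{next}_m(h :: t) = [\,]$ when $\mathrm{next}_m(t) = [\,]$, and $\mathrm{next}_m(h :: t) = x :: x :: t'$ when $\mathrm{next}_m(t) = x :: t'$. The function $\mathrm{lgen}_m : \mathbb{N} \to$ lists is defined by $\mathrm{lgen}_m(0) = [\,]$ and $\mathrm{lgen}_m(x+1) = \mathrm{next}_m(\mathrm{lgen}_m(x))$. -}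

module Defs where

open import Data.Nat using (ℕ; zero; suc; _<?_)
open import Data.List using (List; []; _∷_)
open import Relation.Nullary using (yes; no)

next-overflow : List ℕ → List ℕ
next-overflow []       = []
next-overflow (x ∷ t′) = x ∷ x ∷ t′

next : ℕ → List ℕ → List ℕ
next m []      = 0 ∷ []
next m (h ∷ t) with h <? m
... | yes _ = suc h ∷ t
... | no  _ = next-overflow (next m t)

lgen : ℕ → ℕ → List ℕ
lgen m zero    = []
lgen m (suc x) = next m (lgen m x)

{-# OPTIONS --safe #-}
module Submission where

open import Defs
open import Data.Nat using (ℕ; zero; suc; _≤_; _≥_; _<?_; z≤n)
open import Data.Nat.Properties using (≤-refl; m≤n⇒m≤1+n)
open import Data.Product using (_×_; _,_)
open import Data.List using ([]; _∷_)
open import Data.List.Relation.Unary.All using (All; []; _∷_)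
open import Data.List.Relation.Unary.Linked as Linked using (Linked; []; [-]; _∷_)
open import Relation.Binary.Core using (Rel)
open import Relation.Binary.Definitions using (Reflexive)
open import Relation.Nullary using (yes; no)
open import Relation.Unary using (Pred)

Linked-next-overflow : ∀ {ℓ} {R : Rel ℕ ℓ} → Reflexive R →
                       ∀ {l} → Linked R l → Linked R (next-overflow l)
Linked-next-overflow refl []       = []
Linked-next-overflow refl [-]      = refl ∷ [-]
Linked-next-overflow refl (r ∷ rs) = refl ∷ r ∷ rs

All-next-overflow : ∀ {ℓ} {P : Pred ℕ ℓ} {l} → All P l → All P (next-overflow l)
All-next-overflow []       = []
All-next-overflow (p ∷ ps) = p ∷ p ∷ ps

descending-suc-head : ∀ {h t} → Linked _≥_ (h ∷ t) → Linked _≥_ (suc h ∷ t)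
descending-suc-head [-]      = [-]
descending-suc-head (r ∷ rs) = m≤n⇒m≤1+n r ∷ rs

next-descending : ∀ m {l} → Linked _≥_ l → Linked _≥_ (next m l)
next-descending m {[]}    _ = [-]
next-descending m {h ∷ t} sorted with h <? m
... | yes _ = descending-suc-head sorted
... | no  _ = Linked-next-overflow ≤-refl (next-descending m (Linked.tail sorted))

next-bounded : ∀ m {l} → All (_≤ m) l → All (_≤ m) (next m l)
next-bounded m {[]}    _ = z≤n ∷ []
next-bounded m {h ∷ t} (_ ∷ t≤m) with h <? m
... | yes h<m = h<m ∷ t≤m
... | no  _   = All-next-overflow (next-bounded m t≤m)

lgen-descending : ∀ m x → Linked _≥_ (lgen m x)
lgen-descending m zero    = []
lgen-descending m (suc x) = next-descending m (lgen-descending m x)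

lgen-bounded : ∀ m x → All (_≤ m) (lgen m x)
lgen-bounded m zero    = []
lgen-bounded m (suc x) = next-bounded m (lgen-bounded m x)

theorem6 : (m x : ℕ) → Linked _≥_ (lgen m x) × All (λ y → y ≤ m) (lgen m x)
theorem6 m x = lgen-descending m x , lgen-bounded m x
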